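{- Let $t\in\{0,\dots,m\}$. Let $[\ell,r]$ be a subproblem in the offline recursive tree built on $\hat\sigma_t$, and let $e=(u,v)$ be an edge in $[\ell,r]$ (that is, $e\in E_x$, where $x$ is the midpoint of $[\ell,r]$). - If $C_{u,v}(\hat\sigma_t)$ is defined, then $C_{u,v}(\hat\sigma_t)\in[\ell,r]$. - If $C_{u,v}(\hat\sigma_t)$ is undefined, then $r=m$.
   Context: **Setting.** $V$ is a finite vertex set. $\sigma=e_1,\dots,e_m$ is a sequence of $m$ distinct directed edges on $V$, with $m$ a power of two. A prediction $\hat\sigma$ is a permutation of $\sigma$. **Updated predictions.** $\hat\sigma_0=\hat\sigma$. For $t\ge1$, $e_t$ sits at some position $\hat t\ge t$ in $\hat\sigma_{t-1}$, since $\hat\sigma_{t-1}$ agrees with $\sigma$ on its first $t-1$ positions. The sequence $\hat\sigma_t$ is obtained by moving $e_t$ from position $\hat t$ to position $t$. Edges at positions $t,\dots,\hat t-1$ shift one position later. **Combining time.** For a sequence $\tau$ of these edges and $u,v\in V$, the combining time $C_{u,v}(\tau)$ is the smallest $s\in\{0,\dots,m\}$ such that $u$ and $v$ are in the same strongly connected component of the graph on $V$ with the first $s$ edges of $\tau$. It is undefined if no such $s$ exists. **Offline recursive tree built on $\tau$.** - *Subproblems.* These are the dyadic intervals $[\ell,r]\subseteq[0,m]$ obtained from $[0,m]$ by repeated halving, stopping at length 2. The midpoint is $x=(\ell+r)/2$, the left child is $[\ell,x]$ and the right child is $[x,r]$. - *Graphs.* Each subproblem with midpoint $x$ has a graph $\tilde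 G_x=(V_x,E_x)$. Its vertices are disjoint sets of original vertices ("contracted vertices"). Its edges are original edges, each regarded as joining the contracted vertices that contain its endpoints. - *Root.* $V_x=\{\{v\}:v\in V\}$ and $E_x$ is the set of all $m$ edges. - *Classifying edges.* For each subproblem, compute the strongly connected components of the graph $(V_x,\{e\in E_x: e\text{ has position}\le x\text{ in }\tau\})$. An edge of $E_x$ is a left edge if both its endpoints lie in the same such component, and a right edge otherwise. - *Left child.* Its edge set is the set of left edges. Its vertex set is the set of vertices of $V_x$ incident to a left edge. - *Right child.* Its vertex set is obtained by contracting each strongly connected component of the parent into one vertex (the union of its sets). Its edge set is the set of right edges. - An edge $e$ is said to be in subproblem $[\ell,r]$ if $e\in E_x$. -}

module Defs where

open import Data.Nat using (ℕ; zero; suc; _+_; _^_; _≤_; _<_)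
open import Data.Fin using (Fin)
import Data.Fin as Fin
open import Data.Fin.Subset using (Subset; ⁅_⁆) renaming (_∈_ to _∈ₛ_)
open import Data.Product using (Σ; ∃; ∃-syntax; _×_; _,_; proj₁; proj₂)
open import Data.Product.Properties using (≡-dec)
open import Data.Sum using (_⊎_)
open import Data.List using (List; []; _∷_; take; drop; filter; _++_; length)
open import Data.List.Membership.Propositional using (_∈_)
open import Relation.Nullary using (¬_; ¬?)
open import Relation.Binary.PropositionalEquality using (_≡_)
open import Relation.Binary.Definitions using (DecidableEquality)
open import Function.Bundles using (_⇔_)

-- Vertices are Fin n; a directed edge is an ordered pair (tail , head).
Edge : ℕ → Set
Edge n = Fin n × Fin n

module _ {n : ℕ} where

  _≟ₑ_ : DecidableEquality (Edge n)
  _≟ₑ_ = ≡-dec Fin._≟_ Fin._≟_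

  -- Move edge e to (0-based) position i: the prefix of length i is kept,
  -- e is placed next, the remaining edges keep their relative order
  -- (so the edges between i and e's old position shift one later).
  moveTo : ℕ → Edge n → List (Edge n) → List (Edge n)
  moveTo i e τ = take i τ ++ (e ∷ filter (λ f → ¬? (f ≟ₑ e)) (drop i τ))

  upd : ℕ → List (Edge n) → List (Edge n) → List (Edge n)
  upd i []       τ = τ
  upd i (e ∷ es) τ = upd (suc i) es (moveTo i e τ)

  updatedPrediction : (σ σ̂ : List (Edge n)) → ℕ → List (Edge n)
  updatedPrediction σ σ̂ t = upd 0 (take t σ) σ̂

  data Path (E : List (Edge n)) : Fin n → Fin n → Set where
    nil  : ∀ {a} → Path E a a
    cons : ∀ {a b c} → (a , b) ∈ E → Path E b c → Path E a c

  SameSCC : List (Edge n) → Fin n → Fin n → Set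
  SameSCC E u v = Path E u v × Path E v u

  IsCombiningTime : List (Edge n) → Fin n → Fin n → ℕ → Set
  IsCombiningTime τ u v s =
    s ≤ length τ × SameSCC (take s τ) u v ×
    (∀ s′ → s′ < s → ¬ SameSCC (take s′ τ) u v)

  CombiningTimeUndefined : List (Edge n) → Fin n → Fin n → Set
  CombiningTimeUndefined τ u v = ∀ s → s ≤ length τ → ¬ SameSCC (take s τ) u v

  -- Contracted graphs: vertices are subsets of Fin n (contracted vertices),
  -- edges are original edges.  Both sets are given as predicates.

  record Graph : Set₁ where
    field
      V : Subset n → Set
      E : Edge n → Set
  open Graph public

  -- reachability between contracted vertices using the edges satisfying F;
  -- an edge (a , b) joins the contracted vertices containing a and b.
  data Reach (G : Graph) (F : Edge n → Set) : Subset n → Subset n → Set where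
    here : ∀ {X} → Reach G F X X
    step : ∀ {X Z Y a b} → F (a , b) → a ∈ₛ X → V G Z → b ∈ₛ Z →
           Reach G F Z Y → Reach G F X Y

  module _ (τ : List (Edge n)) (x : ℕ) (G : Graph) where

    -- edges of G with position ≤ x in τ (τ has distinct edges)
    EarlyEdge : Edge n → Set
    EarlyEdge e = E G e × e ∈ take x τ

    SameComp : Subset n → Subset n → Set
    SameComp X Y = V G X × V G Y × Reach G EarlyEdge X Y × Reach G EarlyEdge Y X

    LeftEdge : Edge n → Set
    LeftEdge e = E G e × ∃[ Xa ] ∃[ Xb ]
      (V G Xa × V G Xb × proj₁ e ∈ₛ Xa × proj₂ e ∈ₛ Xb × SameComp Xa Xb)

    RightEdge : Edge n → Set
    RightEdge e = E G e × ¬ LeftEdge e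

    leftChild : Graph
    leftChild = record
      { V = λ X → V G X × ∃[ e ] (LeftEdge e × (proj₁ e ∈ₛ X ⊎ proj₂ e ∈ₛ X))
      ; E = LeftEdge }

    rightChild : Graph
    rightChild = record
      { V = λ W → ∃[ X ] (V G X × (∀ a → (a ∈ₛ W) ⇔ (∃[ Y ] (SameComp X Y × a ∈ₛ Y))))
      ; E = RightEdge }

  rootGraph : List (Edge n) → Graph
  rootGraph τ = record { V = λ X → ∃[ v ] (X ≡ ⁅ v ⁆) ; E = λ e → e ∈ τ }

  -- Subproblems of the offline recursive tree built on τ, with m = 2 ^ k.
  -- Sub τ k j ℓ G : [ℓ , ℓ + 2 ^ j] is a node with graph G.
  -- Actual subproblems have j ≥ 1 (length ≥ 2); midpoint is ℓ + 2 ^ (j - 1).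
  data Sub (τ : List (Edge n)) (k : ℕ) : ℕ → ℕ → Graph → Set₁ where
    root  : Sub τ k k 0 (rootGraph τ)
    left  : ∀ {j ℓ G} → Sub τ k (suc (suc j)) ℓ G →
            Sub τ k (suc j) ℓ (leftChild τ (ℓ + 2 ^ suc j) G)
    right : ∀ {j ℓ G} → Sub τ k (suc (suc j)) ℓ G →
            Sub τ k (suc j) (ℓ + 2 ^ suc j) (rightChild τ (ℓ + 2 ^ suc j) G)

{-# OPTIONS --safe #-}
module Submission where

-- Each subproblem [ℓ , r] with graph G satisfies an invariant: the contracted vertices of G
-- are disjoint and strongly connected by the first ℓ edges; every edge among the first r that
-- lies on a cycle of the first r edges is either still an edge of G or inside every vertex
-- containing its tail; no edge of G has its endpoints strongly connected by fewer than ℓ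
-- edges; and unless r = m, the endpoints of every edge of G are strongly connected by the
-- first r edges.  The invariant passes to both children because, for a ∈ X ∈ V_x, the
-- strongly connected component of a in the first x edges is the union of the component of X
-- in the early-edge graph of G: a cycle of early edges lifts to the contracted graph edge by
-- edge.  The combining time of an edge of G is then ≥ ℓ by the third clause and ≤ r by the
-- fourth, or by r = m ≥ length σ̂_t, since moving edges that are already present never
-- lengthens a prediction.

open import Defs
open import Data.Nat using (ℕ; zero; suc; _+_; _^_; _≤_; _<_; s≤s)
open import Data.Nat.Properties
  using (≤-trans; ≤-refl; ≤-reflexive; <⇒≤; ≮⇒≥; m≤m+n; +-monoʳ-≤; +-assoc; +-identityʳ)
open import Data.Fin using (Fin)
import Data.Fin as Fin
open import Data.Fin.Subset using (Subset; ⁅_⁆) renaming (_∈_ to _∈ₛ_)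
open import Data.Fin.Subset.Properties using (x∈⁅y⁆⇒x≡y; x∈⁅x⁆; ⊆-antisym)
open import Data.Vec using (tabulate)
open import Data.Vec.Properties using (lookup⇒[]=; []=⇒lookup; lookup∘tabulate)
open import Data.Bool.Properties using (T-≡)
open import Data.Product using (∃-syntax; _×_; _,_; proj₁; proj₂)
open import Data.Sum using (_⊎_; inj₁; inj₂; [_,_])
import Data.Sum as Sum
open import Data.List using (List; []; _∷_; length; take; drop; filter)
open import Data.List.Properties using (take-all; filter-notAll)
open import Data.List.Relation.Unary.All using (All; []; _∷_)
open import Data.List.Relation.Unary.AllPairs using (_∷_)
import Data.List.Relation.Unary.All as All
open import Data.List.Relation.Unary.Any using (here; there)
import Data.List.Relation.Unary.Any as Any
open import Data.List.Membership.Propositional using (_∈_)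
open import Data.List.Membership.Propositional.Properties using (∈-filter⁺)
open import Data.List.Relation.Binary.Subset.Propositional using (_⊆_)
import Data.List.Relation.Binary.Sublist.Propositional as Sublist
import Data.List.Relation.Binary.Sublist.Propositional.Properties as Sublist
open import Data.List.Relation.Unary.Unique.Propositional using (Unique)
import Data.List.Relation.Unary.Unique.Propositional.Properties as Unique
open import Data.List.Relation.Binary.Permutation.Propositional using (_↭_; ↭-sym)
open import Data.List.Relation.Binary.Permutation.Propositional.Properties
  using (↭-length; ∈-resp-↭)
open import Relation.Nullary using (¬_; ¬?; Dec; yes; no; contradiction)
open import Relation.Nullary.Decidable using (map′; _×-dec_; _⊎-dec_; isYes; toWitness; fromWitness)
open import Relation.Unary using (Pred; Decidable)
open import Relation.Binary.PropositionalEquality using (_≡_; refl; sym; trans; cong; subst)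
open import Function using (id; _∘_)
open import Function.Bundles using (_⇔_; mk⇔; Equivalence)
open Equivalence using (to; from)

module _ {A : Set} where

  take-mono : ∀ {s t} (xs : List A) → s ≤ t → take s xs ⊆ take t xs
  take-mono xs s≤t = Sublist.lookup (Sublist.take⁺ {xs = xs} s≤t)

  take-⊆ : ∀ s (xs : List A) → take s xs ⊆ xs
  take-⊆ s xs = Sublist.lookup (Sublist.take-⊆ s xs)

module _ {n : ℕ} where

  length-moveTo : ∀ {e : Edge n} i τ → e ∈ drop i τ → length (moveTo i e τ) ≤ length τ
  length-moveTo {e} zero τ e∈τ =
    filter-notAll (λ f → ¬? (f ≟ₑ e)) τ (Any.map (λ e≡f f≢e → f≢e (sym e≡f)) e∈τ)
  length-moveTo (suc i) (_ ∷ τ) e∈ = s≤s (length-moveTo i τ e∈)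

  drop-moveTo : ∀ {e : Edge n} i τ → e ∈ drop i τ →
                drop (suc i) (moveTo i e τ) ≡ filter (λ f → ¬? (f ≟ₑ e)) (drop i τ)
  drop-moveTo zero    τ       _  = refl
  drop-moveTo (suc i) []      ()
  drop-moveTo (suc i) (_ ∷ τ) e∈ = drop-moveTo i τ e∈

  ∈-drop-moveTo : ∀ {e f : Edge n} i τ → e ∈ drop i τ → ¬ e ≡ f → f ∈ drop i τ →
                  f ∈ drop (suc i) (moveTo i e τ)
  ∈-drop-moveTo {e} i τ e∈ e≢f f∈ rewrite drop-moveTo i τ e∈ =
    ∈-filter⁺ (λ g → ¬? (g ≟ₑ e)) f∈ (e≢f ∘ sym)

  length-upd : ∀ i es (τ : List (Edge n)) → Unique es → All (_∈ drop i τ) es →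
               length (upd i es τ) ≤ length τ
  length-upd i []       τ _                 _           = ≤-refl
  length-upd i (e ∷ es) τ (e∉es ∷ es-unique) (e∈ ∷ es∈) =
    ≤-trans (length-upd (suc i) es (moveTo i e τ) es-unique
              (All.zipWith (λ (e≢f , f∈) → ∈-drop-moveTo i τ e∈ e≢f f∈) (e∉es , es∈)))
            (length-moveTo i τ e∈)

  length-updatedPrediction : ∀ (σ σ̂ : List (Edge n)) t → Unique σ → σ̂ ↭ σ →
                             length (updatedPrediction σ σ̂ t) ≤ length σ
  length-updatedPrediction σ σ̂ t σ-unique σ̂↭σ =
    ≤-trans (length-upd 0 (take t σ) σ̂ (Unique.take⁺ t σ-unique)
              (All.tabulate (∈-resp-↭ (↭-sym σ̂↭σ) ∘ take-⊆ t σ)))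
            (≤-reflexive (↭-length σ̂↭σ))

  private variable
    a b c d u v : Fin n
    F F′ : List (Edge n)

  _++ₚ_ : Path F a b → Path F b c → Path F a c
  nil      ++ₚ q = q
  cons e p ++ₚ q = cons e (p ++ₚ q)

  Path-mono : F ⊆ F′ → Path F a b → Path F′ a b
  Path-mono F⊆F′ nil        = nil
  Path-mono F⊆F′ (cons e p) = cons (F⊆F′ e) (Path-mono F⊆F′ p)

  SameSCC-mono : F ⊆ F′ → SameSCC F a b → SameSCC F′ a b
  SameSCC-mono F⊆F′ (p , q) = Path-mono F⊆F′ p , Path-mono F⊆F′ q

  Path-[]⁻ : Path [] a b → a ≡ b
  Path-[]⁻ nil = refl

  Path-∷⁻ : Path ((c , d) ∷ F) a b → Path F a b ⊎ (Path F a c × Path F d b)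
  Path-∷⁻ nil = inj₁ nil
  Path-∷⁻ (cons (here refl) p) = inj₂ (nil , [ id , proj₂ ] (Path-∷⁻ p))
  Path-∷⁻ (cons (there e) p) with Path-∷⁻ p
  ... | inj₁ q       = inj₁ (cons e q)
  ... | inj₂ (q , r) = inj₂ (cons e q , r)

  path? : ∀ F (a b : Fin n) → Dec (Path F a b)
  path? [] a b = map′ (λ { refl → nil }) Path-[]⁻ (a Fin.≟ b)
  path? ((c , d) ∷ F) a b =
    map′ [ Path-mono there , (λ (p , q) → Path-mono there p ++ₚ cons (here refl) (Path-mono there q)) ]
         Path-∷⁻
         (path? F a b ⊎-dec (path? F a c ×-dec path? F d b))

  sameSCC? : ∀ F (a b : Fin n) → Dec (SameSCC F a b)
  sameSCC? F a b = path? F a b ×-dec path? F b a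

  Reach-trans : ∀ {G : Graph {n}} {P X Y Z} → Reach G P X Y → Reach G P Y Z → Reach G P X Z
  Reach-trans here                 r′ = r′
  Reach-trans (step p a∈ vZ b∈ r) r′ = step p a∈ vZ b∈ (Reach-trans r r′)

  subset : ∀ {p} {P : Pred (Fin n) p} → Decidable P → Subset n
  subset P? = tabulate (isYes ∘ P?)

  ∈-subset : ∀ {p} {P : Pred (Fin n) p} (P? : Decidable P) → c ∈ₛ subset P? ⇔ P c
  ∈-subset {c} P? = mk⇔
    (λ c∈ → toWitness (from T-≡ (trans (sym (lookup∘tabulate (isYes ∘ P?) c)) ([]=⇒lookup c∈))))
    (λ Pc → lookup⇒[]= c _ (trans (lookup∘tabulate (isYes ∘ P?) c) (to T-≡ (fromWitness Pc))))

  module _ (τ : List (Edge n)) (m : ℕ) where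

    record Invariant (ℓ r : ℕ) (G : Graph) : Set where
      field
        disjoint    : ∀ {X Y a} → V G X → V G Y → a ∈ₛ X → a ∈ₛ Y → X ≡ Y
        connected   : ∀ {X a b} → V G X → a ∈ₛ X → b ∈ₛ X → Path (take ℓ τ) a b
        covered     : ∀ {a b} → E G (a , b) →
                      (∃[ X ] (V G X × a ∈ₛ X)) × (∃[ Y ] (V G Y × b ∈ₛ Y))
        closed      : ∀ {c d} → (c , d) ∈ take r τ → Path (take r τ) d c →
                      E G (c , d) ⊎ (∀ {Z} → V G Z → c ∈ₛ Z → d ∈ₛ Z)
        apartBefore : ∀ {u v} → E G (u , v) → ∀ s → s < ℓ → ¬ SameSCC (take s τ) u v
        joinedAt    : r ≡ m ⊎ (∀ {u v} → E G (u , v) → SameSCC (take r τ) u v)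

    open Invariant

    rootInvariant : Invariant 0 m (rootGraph τ)
    rootInvariant .disjoint (v , refl) (w , refl) a∈ a∈′ =
      cong ⁅_⁆ (trans (sym (x∈⁅y⁆⇒x≡y v a∈)) (x∈⁅y⁆⇒x≡y w a∈′))
    rootInvariant .connected (v , refl) a∈ b∈
      with refl ← x∈⁅y⁆⇒x≡y v a∈ | refl ← x∈⁅y⁆⇒x≡y v b∈ = nil
    rootInvariant .covered {a} {b} _ =
      (⁅ a ⁆ , (a , refl) , x∈⁅x⁆ a) , (⁅ b ⁆ , (b , refl) , x∈⁅x⁆ b)
    rootInvariant .closed cd∈ _ = inj₁ (take-⊆ m τ cd∈)
    rootInvariant .apartBefore _ _ ()
    rootInvariant .joinedAt = inj₁ refl

    module Children {ℓ x r : ℕ} {G : Graph} (ℓ≤x : ℓ ≤ x) (x≤r : x ≤ r) (I : Invariant ℓ r G) where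

      private module P = Invariant I

      _∼_ : Subset n → Subset n → Set
      _∼_ = SameComp τ x G

      ∼-sym : ∀ {X Y} → X ∼ Y → Y ∼ X
      ∼-sym (vX , vY , X→Y , Y→X) = vY , vX , Y→X , X→Y

      ∼-trans : ∀ {X Y Z} → X ∼ Y → Y ∼ Z → X ∼ Z
      ∼-trans (vX , _ , X→Y , Y→X) (_ , vZ , Y→Z , Z→Y) =
        vX , vZ , Reach-trans X→Y Y→Z , Reach-trans Z→Y Y→X

      ∼-vertex : ∀ {X Y} → X ∼ Y → V G Y
      ∼-vertex (_ , vY , _) = vY

      connectedAtMid : ∀ {X} → V G X → a ∈ₛ X → b ∈ₛ X → SameSCC (take x τ) a b
      connectedAtMid vX a∈ b∈ =
        SameSCC-mono (take-mono τ ℓ≤x) (P.connected vX a∈ b∈ , P.connected vX b∈ a∈)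

      Reach⇒Path : ∀ {X Y} → Reach G (EarlyEdge τ x G) X Y → V G X → a ∈ₛ X → b ∈ₛ Y →
                   Path (take x τ) a b
      Reach⇒Path here vX a∈ b∈ = proj₁ (connectedAtMid vX a∈ b∈)
      Reach⇒Path (step (_ , a′b′∈) a′∈ vZ b′∈ reach) vX a∈ b∈ =
        proj₁ (connectedAtMid vX a∈ a′∈) ++ₚ cons a′b′∈ (Reach⇒Path reach vZ b′∈ b∈)

      -- Each edge of a path on a cycle lies on a cycle, so by closedness it is either an
      -- early edge of G or internal to the current vertex.
      cycle⇒Reach : ∀ {Z} → Path (take x τ) c d → Path (take x τ) d c → V G Z → c ∈ₛ Z →
                    ∃[ Z′ ] (V G Z′ × d ∈ₛ Z′ × Reach G (EarlyEdge τ x G) Z Z′)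
      cycle⇒Reach nil _ vZ c∈ = _ , vZ , c∈ , here
      cycle⇒Reach {d = d} {Z = Z} (cons cc′∈ p) q vZ c∈ =
        [ viaEdge , (λ inside → cycle⇒Reach p q′ vZ (inside vZ c∈)) ]
          (P.closed (take-mono τ x≤r cc′∈) (Path-mono (take-mono τ x≤r) (p ++ₚ q)))
        where
        q′ = q ++ₚ cons cc′∈ nil
        viaEdge : E G _ → ∃[ Z′ ] (V G Z′ × d ∈ₛ Z′ × Reach G (EarlyEdge τ x G) Z Z′)
        viaEdge cc′∈G =
          let (Z₁ , vZ₁ , c′∈) = proj₂ (P.covered cc′∈G)
              (Z′ , vZ′ , d∈ , reach) = cycle⇒Reach p q′ vZ₁ c′∈
          in Z′ , vZ′ , d∈ , step (cc′∈G , cc′∈) c∈ vZ₁ c′∈ reach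

      SameSCC⇒∼ : ∀ {X} → V G X → a ∈ₛ X → SameSCC (take x τ) a c → ∃[ Y ] (X ∼ Y × c ∈ₛ Y)
      SameSCC⇒∼ vX a∈ (p , q) with cycle⇒Reach p q vX a∈
      ... | Y , vY , c∈ , X→Y with cycle⇒Reach q p vY c∈
      ...   | X′ , vX′ , a∈′ , Y→X′ with refl ← P.disjoint vX vX′ a∈ a∈′ =
        Y , (vX , vY , X→Y , Y→X′) , c∈

      ∼⇒SameSCC : ∀ {X Y} → V G X → a ∈ₛ X → X ∼ Y → c ∈ₛ Y → SameSCC (take x τ) a c
      ∼⇒SameSCC vX a∈ (_ , vY , X→Y , Y→X) c∈ = Reach⇒Path X→Y vX a∈ c∈ , Reach⇒Path Y→X vY c∈ a∈

      LeftEdge⇒SameSCC : LeftEdge τ x G (u , v) → SameSCC (take x τ) u v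
      LeftEdge⇒SameSCC (_ , _ , _ , vX , _ , u∈ , v∈ , X∼Y) = ∼⇒SameSCC vX u∈ X∼Y v∈

      SameSCC⇒LeftEdge : E G (u , v) → SameSCC (take x τ) u v → LeftEdge τ x G (u , v)
      SameSCC⇒LeftEdge uv∈G uv-scc =
        let (X , vX , u∈) = proj₁ (P.covered uv∈G)
            (Y , X∼Y , v∈) = SameSCC⇒∼ vX u∈ uv-scc
        in uv∈G , X , Y , vX , ∼-vertex X∼Y , u∈ , v∈ , X∼Y

      leftInvariant : Invariant ℓ x (leftChild τ x G)
      leftInvariant .disjoint vX vY = P.disjoint (proj₁ vX) (proj₁ vY)
      leftInvariant .connected vX = P.connected (proj₁ vX)
      leftInvariant .covered uv@(_ , X , Y , vX , vY , u∈ , v∈ , _) =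
        (X , (vX , _ , uv , inj₁ u∈) , u∈) , (Y , (vY , _ , uv , inj₂ v∈) , v∈)
      leftInvariant .closed cd∈ q =
        Sum.map (λ cd∈G → SameSCC⇒LeftEdge cd∈G (cons cd∈ nil , q)) (λ inside vZ → inside (proj₁ vZ))
          (P.closed (take-mono τ x≤r cd∈) (Path-mono (take-mono τ x≤r) q))
      leftInvariant .apartBefore = P.apartBefore ∘ proj₁
      leftInvariant .joinedAt = inj₂ LeftEdge⇒SameSCC

      sccAtMid : Fin n → Subset n
      sccAtMid a = subset (sameSCC? (take x τ) a)

      sccAtMid-vertex : ∀ {X} → V G X → a ∈ₛ X → V (rightChild τ x G) (sccAtMid a)
      sccAtMid-vertex {X = X} vX a∈ = X , vX , λ c →
        mk⇔ (SameSCC⇒∼ vX a∈ ∘ to (∈-subset _))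
            (λ (Y , X∼Y , c∈) → from (∈-subset _) (∼⇒SameSCC vX a∈ X∼Y c∈))

      rightVertex-covered : ∀ {W} → V (rightChild τ x G) W → a ∈ₛ W → ∃[ Y ] (V G Y × a ∈ₛ Y)
      rightVertex-covered (_ , _ , W⇔) a∈ =
        let (Y , X∼Y , a∈Y) = to (W⇔ _) a∈ in Y , ∼-vertex X∼Y , a∈Y

      rightVertex-scc : ∀ {W} → V (rightChild τ x G) W → a ∈ₛ W →
                        ∀ c → c ∈ₛ W ⇔ SameSCC (take x τ) a c
      rightVertex-scc (_ , _ , W⇔) a∈ c =
        let (Y , X∼Y , a∈Y) = to (W⇔ _) a∈ in
        mk⇔ (λ c∈ → let (Z , X∼Z , c∈Z) = to (W⇔ c) c∈
                    in ∼⇒SameSCC (∼-vertex X∼Y) a∈Y (∼-trans (∼-sym X∼Y) X∼Z) c∈Z)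
            (λ ac-scc → let (Z , Y∼Z , c∈Z) = SameSCC⇒∼ (∼-vertex X∼Y) a∈Y ac-scc
                        in from (W⇔ c) (Z , ∼-trans X∼Y Y∼Z , c∈Z))

      rightInvariant : Invariant x r (rightChild τ x G)
      rightInvariant .disjoint vW₁ vW₂ a∈₁ a∈₂ =
        ⊆-antisym (λ c∈ → from (rightVertex-scc vW₂ a∈₂ _) (to (rightVertex-scc vW₁ a∈₁ _) c∈))
                  (λ c∈ → from (rightVertex-scc vW₁ a∈₁ _) (to (rightVertex-scc vW₂ a∈₂ _) c∈))
      rightInvariant .connected vW a∈ b∈ = proj₁ (to (rightVertex-scc vW a∈ _) b∈)
      rightInvariant .covered {a} {b} (ab∈G , _) =
        let ((X , vX , a∈) , (Y , vY , b∈)) = P.covered ab∈G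
        in (sccAtMid a , sccAtMid-vertex vX a∈ , from (∈-subset _) (nil , nil)) ,
           (sccAtMid b , sccAtMid-vertex vY b∈ , from (∈-subset _) (nil , nil))
      rightInvariant .closed {c} {d} cd∈ q with P.closed cd∈ q | sameSCC? (take x τ) c d
      ... | inj₁ cd∈G | no ¬cd-scc = inj₁ (cd∈G , ¬cd-scc ∘ LeftEdge⇒SameSCC)
      ... | inj₁ _    | yes cd-scc = inj₂ λ vW c∈ → from (rightVertex-scc vW c∈ d) cd-scc
      ... | inj₂ inside | _ = inj₂ λ vW c∈ →
        let (Y , vY , c∈Y) = rightVertex-covered vW c∈
        in from (rightVertex-scc vW c∈ d) (connectedAtMid vY c∈Y (inside vY c∈Y))
      rightInvariant .apartBefore (uv∈G , notLeft) s s<x uv-scc =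
        notLeft (SameSCC⇒LeftEdge uv∈G (SameSCC-mono (take-mono τ (<⇒≤ s<x)) uv-scc))
      rightInvariant .joinedAt = Sum.map₂ (λ joined uv → joined (proj₁ uv)) P.joinedAt

  module _ {τ m ℓ r G} (I : Invariant τ m ℓ r G) (uv∈G : E G (u , v)) where

    open Invariant I

    combiningTime-≥ : ∀ {s} → IsCombiningTime τ u v s → ℓ ≤ s
    combiningTime-≥ {s} (_ , uv-scc , _) = ≮⇒≥ (λ s<ℓ → apartBefore uv∈G s s<ℓ uv-scc)

    combiningTime-≤ : length τ ≤ m → ∀ {s} → IsCombiningTime τ u v s → s ≤ r
    combiningTime-≤ τ≤m (s≤τ , _ , minimal) with joinedAt
    ... | inj₁ r≡m   = ≤-trans s≤τ (≤-trans τ≤m (≤-reflexive (sym r≡m)))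
    ... | inj₂ joined = ≮⇒≥ (λ r<s → minimal _ r<s (joined uv∈G))

    combiningTimeUndefined⇒≡ : CombiningTimeUndefined τ u v → r ≡ m
    combiningTimeUndefined⇒≡ undefined with joinedAt
    ... | inj₁ r≡m    = r≡m
    ... | inj₂ joined =
      contradiction (subst (λ τ′ → SameSCC τ′ u v) (sym (take-all (length τ) τ ≤-refl))
                           (SameSCC-mono (take-⊆ r τ) (joined uv∈G)))
                    (undefined (length τ) ≤-refl)

  ℓ+2^[1+j]≤ℓ+2^[2+j] : ∀ ℓ j → ℓ + 2 ^ suc j ≤ ℓ + 2 ^ suc (suc j)
  ℓ+2^[1+j]≤ℓ+2^[2+j] ℓ j = +-monoʳ-≤ ℓ (m≤m+n (2 ^ suc j) _)

  ℓ+2^[2+j]≡ℓ+2^[1+j]+2^[1+j] : ∀ ℓ j → ℓ + 2 ^ suc (suc j) ≡ (ℓ + 2 ^ suc j) + 2 ^ suc j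
  ℓ+2^[2+j]≡ℓ+2^[1+j]+2^[1+j] ℓ j =
    trans (cong (λ h → ℓ + (2 ^ suc j + h)) (+-identityʳ (2 ^ suc j)))
          (sym (+-assoc ℓ (2 ^ suc j) (2 ^ suc j)))

  subproblemInvariant : ∀ {τ k J ℓ G} → Sub τ k J ℓ G → Invariant τ (2 ^ k) ℓ (ℓ + 2 ^ J) G
  subproblemInvariant {τ} root = rootInvariant τ _
  subproblemInvariant {τ} (left {j} {ℓ} sub) =
    Children.leftInvariant τ _ (m≤m+n ℓ _) (ℓ+2^[1+j]≤ℓ+2^[2+j] ℓ j) (subproblemInvariant sub)
  subproblemInvariant {τ} {k} (right {j} {ℓ} {G} sub) =
    subst (λ r → Invariant τ (2 ^ k) mid r (rightChild τ mid G)) (ℓ+2^[2+j]≡ℓ+2^[1+j]+2^[1+j] ℓ j)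
      (Children.rightInvariant τ _ (m≤m+n ℓ _) (ℓ+2^[1+j]≤ℓ+2^[2+j] ℓ j) (subproblemInvariant sub))
    where mid = ℓ + 2 ^ suc j

lemma3 : ∀ {n : ℕ} (k : ℕ) (σ σ̂ : List (Edge n)) →
    Unique σ → length σ ≡ 2 ^ k → σ̂ ↭ σ →
    (t : ℕ) → t ≤ 2 ^ k →
    ∀ {j ℓ : ℕ} {G : Graph} →
    Sub (updatedPrediction σ σ̂ t) k (suc j) ℓ G →
    (u v : Fin n) → E G (u , v) →
    ((s : ℕ) → IsCombiningTime (updatedPrediction σ σ̂ t) u v s →
       ℓ ≤ s × s ≤ ℓ + 2 ^ suc j)
    × (CombiningTimeUndefined (updatedPrediction σ σ̂ t) u v →
       ℓ + 2 ^ suc j ≡ 2 ^ k)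
lemma3 k σ σ̂ σ-unique σ≡m σ̂↭σ t _ sub u v uv∈G =
  (λ _ isTime → combiningTime-≥ I uv∈G isTime , combiningTime-≤ I uv∈G τ≤m isTime) ,
  combiningTimeUndefined⇒≡ I uv∈G
  where
  τ = updatedPrediction σ σ̂ t
  I = subproblemInvariant sub
  τ≤m : length τ ≤ 2 ^ k
  τ≤m = ≤-trans (length-updatedPrediction σ σ̂ t σ-unique σ̂↭σ) (≤-reflexive σ≡m)
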